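{- For all integers $k\ge 4$ and $q\ge 1$, the graph $G(q,k)$ is $2K_2$-free.
   Context: For integers $q\ge 1$ and $k\ge 3$, $G(q,k)$ is the graph on vertex set $\{v_0,v_1,\dots,v_{kq}\}$ in which, with all indices taken modulo $kq+1$, the neighbourhood of $v_i$ is $\{v_{i-1},v_{i+1}\}\cup\{v_{i+kj+m} : m=2,3,\dots,k-1,\ j=0,1,\dots,q-1\}$. $2K_2$ is the disjoint union of two edges (also written $2P_2$). A graph is $H$-free if it contains no induced subgraph isomorphic to $H$. -}

module Defs where

open import Data.Nat using (ℕ; suc; _+_; _*_; _∸_; _≤_; _<_)
open import Data.Nat.DivMod using (_%_)
open import Data.Fin using (Fin; toℕ)
open import Data.Product using (∃; ∃-syntax; _×_)
open import Data.Sum using (_⊎_)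
open import Relation.Binary.PropositionalEquality using (_≡_; _≢_)
open import Relation.Nullary using (¬_)

N : ℕ → ℕ → ℕ
N q k = suc (k * q)

Adj : (q k : ℕ) → Fin (N q k) → Fin (N q k) → Set
Adj q k vi vj =
  (j ≡ (i + 1) % N q k)
  ⊎ (i ≡ (j + 1) % N q k)
  ⊎ (∃[ m ] ∃[ j' ] (2 ≤ m × m ≤ k ∸ 1 × j' < q × j ≡ (i + k * j' + m) % N q k))
  where
    i = toℕ vi
    j = toℕ vj

-- Edge relation of the (simple, undirected) graph: symmetric closure of the neighbourhood
-- relation (the relation above is already symmetric; this just avoids depending on that).
Edge : (q k : ℕ) → Fin (N q k) → Fin (N q k) → Set
Edge q k a b = Adj q k a b ⊎ Adj q k b a

Induced2K2 : (q k : ℕ) → Fin (N q k) → Fin (N q k) → Fin (N q k) → Fin (N q k) → Set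
Induced2K2 q k a b c d =
  a ≢ b × a ≢ c × a ≢ d × b ≢ c × b ≢ d × c ≢ d
  × Edge q k a b × Edge q k c d
  × ¬ Edge q k a c × ¬ Edge q k a d × ¬ Edge q k b c × ¬ Edge q k b d

2K2-free : (q k : ℕ) → Set
2K2-free q k = ∀ a b c d → ¬ Induced2K2 q k a b c d

-- G(q,k) is the circulant graph on ℤ/(kq+1) whose connection set is {±1} together with the residues
-- kj + m (2 ≤ m ≤ k−1, j < q).  Hence two distinct vertices are non-adjacent exactly when the forward
-- difference from one to the other is a gap kt + e with 1 ≤ t < q and e ∈ {0,1}.  In an induced 2K₂
-- with edges ab and cd, the non-edges a→c→b→d→a are four gaps whose sum is a multiple of kq + 1.
-- Reading this sum modulo k shows that the four e's cannot all agree, so two consecutive gaps have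
-- e-values adding up to 1.  Their sum k(t + t′) + 1, with 2 ≤ t + t′ ≤ 2q − 2, is then 0 or a gap
-- modulo kq + 1, although it is the difference across one of the edges ab, cd or ba.
module Submission where

open import Defs
open import Data.Nat
open import Data.Nat.Properties
open import Data.Nat.DivMod
open import Data.Nat.Divisibility using (_∣_; divides)
open import Data.Nat.Tactic.RingSolver using (solve-∀)
open import Algebra.Properties.CommutativeSemigroup +-commutativeSemigroup
  using (interchange; xy∙z≈xz∙y; x∙yz≈y∙xz)
open import Data.Fin using (Fin; toℕ)
open import Data.Fin.Properties using (toℕ<n; toℕ-injective)
open import Data.Product using (∃-syntax; _×_; _,_)
open import Data.Sum using (_⊎_; inj₁; inj₂; swap)
open import Data.Empty using (⊥)
open import Function using (_∘_; case_of_)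
open import Relation.Binary.PropositionalEquality
open import Relation.Binary.Definitions using (tri<; tri≈; tri>)
open import Relation.Nullary using (¬_; yes; no; contradiction)

remainder-unique : ∀ {n α β A B} → α < n → β < n → α + A * n ≡ β + B * n → α ≡ β
remainder-unique {n@(suc _)} {α} {β} {A} {B} α<n β<n eq = begin
  α               ≡⟨ m<n⇒m%n≡m α<n ⟨
  α % n           ≡⟨ [m+kn]%n≡m%n α A n ⟨
  (α + A * n) % n ≡⟨ cong (_% n) eq ⟩
  (β + B * n) % n ≡⟨ [m+kn]%n≡m%n β B n ⟩
  β % n           ≡⟨ m<n⇒m%n≡m β<n ⟩
  β               ∎
  where open ≡-Reasoning

record Shift {n : ℕ} (d : ℕ) (a b : Fin n) : Set where
  constructor shift
  field
    laps   : ℕ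
    lands  : toℕ a + d ≡ toℕ b + laps * n

module _ {n : ℕ} where

  %⇒shift : ∀ {d} {a b : Fin n} .{{_ : NonZero n}} → toℕ b ≡ (toℕ a + d) % n → Shift d a b
  %⇒shift {d} {a} {b} b≡ =
    shift ((toℕ a + d) / n) (trans (m≡m%n+[m/n]*n (toℕ a + d) n) (cong (_+ _) (sym b≡)))

  shift⇒% : ∀ {d} {a b : Fin n} .{{_ : NonZero n}} → Shift d a b → toℕ b ≡ (toℕ a + d) % n
  shift⇒% {d} {a} {b} (shift w eq) = sym (begin
    (toℕ a + d) % n      ≡⟨ cong (_% n) eq ⟩
    (toℕ b + w * n) % n  ≡⟨ [m+kn]%n≡m%n (toℕ b) w n ⟩
    toℕ b % n            ≡⟨ m<n⇒m%n≡m (toℕ<n b) ⟩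
    toℕ b                ∎)
    where open ≡-Reasoning

  shift-zero : ∀ {a b : Fin n} → Shift 0 a b → a ≡ b
  shift-zero {a} {b} (shift w eq) =
    toℕ-injective (remainder-unique {A = 0} {B = w} (toℕ<n a) (toℕ<n b) eq)

  shift-unique : ∀ {x y} {a b : Fin n} → x < n → y < n → Shift x a b → Shift y a b → x ≡ y
  shift-unique {x} {y} {a} {b} x<n y<n (shift w eqx) (shift w′ eqy) =
    remainder-unique {A = w′} {B = w} x<n y<n (+-cancelˡ-≡ (toℕ a) _ _ (begin
      toℕ a + (x + w′ * n)     ≡⟨ +-assoc (toℕ a) x _ ⟨
      toℕ a + x + w′ * n       ≡⟨ cong (_+ w′ * n) eqx ⟩
      toℕ b + w * n + w′ * n   ≡⟨ xy∙z≈xz∙y (toℕ b) (w * n) (w′ * n) ⟩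
      toℕ b + w′ * n + w * n   ≡⟨ cong (_+ w * n) eqy ⟨
      toℕ a + y + w * n        ≡⟨ +-assoc (toℕ a) y _ ⟩
      toℕ a + (y + w * n)      ∎))
    where open ≡-Reasoning

  shift-trans : ∀ {d e} {a b c : Fin n} → Shift d a b → Shift e b c → Shift (d + e) a c
  shift-trans {d} {e} {a} {b} {c} (shift w ab) (shift w′ bc) = shift (w′ + w) (begin
    toℕ a + (d + e)        ≡⟨ +-assoc (toℕ a) d e ⟨
    toℕ a + d + e          ≡⟨ cong (_+ e) ab ⟩
    toℕ b + w * n + e      ≡⟨ xy∙z≈xz∙y (toℕ b) (w * n) e ⟩
    toℕ b + e + w * n      ≡⟨ cong (_+ w * n) bc ⟩
    toℕ c + w′ * n + w * n ≡⟨ +-assoc (toℕ c) (w′ * n) (w * n) ⟩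
    toℕ c + (w′ * n + w * n) ≡⟨ cong (toℕ c +_) (*-distribʳ-+ n w′ w) ⟨
    toℕ c + (w′ + w) * n   ∎)
    where open ≡-Reasoning

  shift-loop : ∀ {d} {a : Fin n} → Shift d a a → n ∣ d
  shift-loop {d} {a} (shift w eq) = divides w (+-cancelˡ-≡ (toℕ a) d (w * n) eq)

  shift-unwrap : ∀ {d} {a b : Fin n} → Shift (n + d) a b → Shift d a b
  shift-unwrap {d} {a} {b} (shift zero eq) = contradiction n≤b (<⇒≱ (toℕ<n b))
    where
      n≤b : n ≤ toℕ b
      n≤b = ≤-trans (≤-trans (m≤m+n n d) (m≤n+m (n + d) (toℕ a)))
                    (≤-reflexive (trans eq (+-identityʳ (toℕ b))))
  shift-unwrap {d} {a} {b} (shift (suc w) eq) = shift w (+-cancelˡ-≡ n _ _ (begin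
    n + (toℕ a + d)        ≡⟨ x∙yz≈y∙xz n (toℕ a) d ⟩
    toℕ a + (n + d)        ≡⟨ eq ⟩
    toℕ b + (n + w * n)    ≡⟨ x∙yz≈y∙xz (toℕ b) n (w * n) ⟩
    n + (toℕ b + w * n)    ∎))
    where open ≡-Reasoning

  shift-reverse : ∀ {d} {a b : Fin n} → d ≤ n → Shift d a b → Shift (n ∸ d) b a
  shift-reverse {d} {a} {b} d≤n (shift zero eq) = shift 1 (begin
    toℕ b + (n ∸ d)        ≡⟨ cong (_+ (n ∸ d)) (trans eq (+-identityʳ (toℕ b))) ⟨
    toℕ a + d + (n ∸ d)    ≡⟨ +-assoc (toℕ a) d (n ∸ d) ⟩
    toℕ a + (d + (n ∸ d))  ≡⟨ cong (toℕ a +_) (trans (m+[n∸m]≡n d≤n) (sym (*-identityˡ n))) ⟩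
    toℕ a + 1 * n          ∎)
    where open ≡-Reasoning
  shift-reverse {d} {a} {b} d≤n (shift (suc zero) eq) = shift 0 (+-cancelʳ-≡ d _ _ (begin
    toℕ b + (n ∸ d) + d    ≡⟨ +-assoc (toℕ b) (n ∸ d) d ⟩
    toℕ b + (n ∸ d + d)    ≡⟨ cong (toℕ b +_) (trans (m∸n+n≡m d≤n) (sym (*-identityˡ n))) ⟩
    toℕ b + 1 * n          ≡⟨ eq ⟨
    toℕ a + d              ≡⟨ cong (_+ d) (+-identityʳ (toℕ a)) ⟨
    toℕ a + 0 + d          ∎))
    where open ≡-Reasoning
  shift-reverse {d} {a} {b} d≤n (shift (suc (suc w)) eq) =
    contradiction too-big (<⇒≱ (+-mono-<-≤ (toℕ<n a) d≤n))
    where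
      too-big : n + n ≤ toℕ a + d
      too-big = ≤-trans (+-monoʳ-≤ n (m≤m+n n (w * n)))
                        (≤-trans (m≤n+m _ (toℕ b)) (≤-reflexive (sym eq)))

  shift-exists : (a b : Fin n) → ∃[ d ] d < n × Shift d a b
  shift-exists a b with toℕ a ≤? toℕ b
  ... | yes a≤b = toℕ b ∸ toℕ a , ≤-<-trans (m∸n≤m (toℕ b) (toℕ a)) (toℕ<n b)
                , shift 0 (trans (m+[n∸m]≡n a≤b) (sym (+-identityʳ (toℕ b))))
  ... | no a≰b = n ∸ toℕ a + toℕ b , d<n , shift 1 (begin
    toℕ a + (n ∸ toℕ a + toℕ b)  ≡⟨ +-assoc (toℕ a) (n ∸ toℕ a) (toℕ b) ⟨
    toℕ a + (n ∸ toℕ a) + toℕ b  ≡⟨ cong (_+ toℕ b) (m+[n∸m]≡n (<⇒≤ (toℕ<n a))) ⟩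
    n + toℕ b                    ≡⟨ +-comm n (toℕ b) ⟩
    toℕ b + n                    ≡⟨ cong (toℕ b +_) (*-identityˡ n) ⟨
    toℕ b + 1 * n                ∎)
    where
      open ≡-Reasoning
      d<n : n ∸ toℕ a + toℕ b < n
      d<n = ≤-trans (+-monoʳ-< (n ∸ toℕ a) (≰⇒> a≰b)) (≤-reflexive (m∸n+n≡m (<⇒≤ (toℕ<n a))))

k*t+r<k*q : ∀ {k q t r} → t < q → r < k → k * t + r < k * q
k*t+r<k*q {k} {q} {t} {r} t<q r<k = begin-strict
  k * t + r  <⟨ +-monoʳ-< (k * t) r<k ⟩
  k * t + k  ≡⟨ trans (+-comm (k * t) k) (sym (*-suc k t)) ⟩
  k * suc t  ≤⟨ *-monoʳ-≤ k t<q ⟩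
  k * q      ∎
  where open ≤-Reasoning

data Gap (q k : ℕ) : ℕ → Set where
  gap : ∀ t e → 1 ≤ t → t < q → e ≤ 1 → Gap q k (k * t + e)

data Chord (q k : ℕ) : ℕ → Set where
  chord : ∀ j m → 2 ≤ m → m ≤ k ∸ 1 → j < q → Chord q k (k * j + m)

data Difference (q k : ℕ) : ℕ → Set where
  zero-diff  : Difference q k 0
  one-diff   : Difference q k 1
  kq-diff    : Difference q k (k * q)
  chord-diff : ∀ {d} → Chord q k d → Difference q k d
  gap-diff   : ∀ {d} → Gap q k d → Difference q k d

data Unjoined (q k : ℕ) : ℕ → Set where
  loop  : Unjoined q k 0
  apart : ∀ {d} → Gap q k d → Unjoined q k d
  wrap  : ∀ {d} → Unjoined q k d → Unjoined q k (N q k + d)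

gap-reverse : ∀ {q k d} → Gap q k d → Gap q k (N q k ∸ d)
gap-reverse {q} {k} (gap t e 1≤t t<q e≤1) =
  subst (Gap q k) (sym complement)
    (gap (q ∸ t) (1 ∸ e) (m<n⇒0<n∸m t<q) (∸-monoʳ-< 1≤t (<⇒≤ t<q)) (m∸n≤m 1 e))
  where
    open ≡-Reasoning
    sum : k * (q ∸ t) + (1 ∸ e) + (k * t + e) ≡ N q k
    sum = begin
      k * (q ∸ t) + (1 ∸ e) + (k * t + e)    ≡⟨ interchange (k * (q ∸ t)) (1 ∸ e) (k * t) e ⟩
      k * (q ∸ t) + k * t + (1 ∸ e + e)      ≡⟨ cong₂ _+_ (sym (*-distribˡ-+ k (q ∸ t) t)) (m∸n+n≡m e≤1) ⟩
      k * (q ∸ t + t) + 1                    ≡⟨ cong (λ s → k * s + 1) (m∸n+n≡m (<⇒≤ t<q)) ⟩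
      k * q + 1                              ≡⟨ +-comm (k * q) 1 ⟩
      N q k                                  ∎
    complement : N q k ∸ (k * t + e) ≡ k * (q ∸ t) + (1 ∸ e)
    complement = trans (cong (_∸ (k * t + e)) (sym sum)) (m+n∸n≡m _ (k * t + e))

unjoined-k*t+1 : ∀ {q k t} → 1 ≤ t → t < q + q → Unjoined q k (k * t + 1)
unjoined-k*t+1 {q} {k} {t} 1≤t t<2q with <-cmp t q
... | tri< t<q _ _ = apart (gap t 1 1≤t t<q ≤-refl)
... | tri≈ _ refl _ = subst (Unjoined q k) (trans (+-identityʳ (N q k)) (+-comm 1 (k * q))) (wrap loop)
... | tri> _ _ q<t with m≤n⇒∃[o]m+o≡n (<⇒≤ q<t)
...   | o , refl = subst (Unjoined q k) (wrapped k q o) (wrap (apart (gap o 0 1≤o o<q z≤n)))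
  where
    1≤o : 1 ≤ o
    1≤o = +-cancelˡ-< q 0 o (subst (_< q + o) (sym (+-identityʳ q)) q<t)
    o<q : o < q
    o<q = +-cancelˡ-< q o q t<2q
    wrapped : ∀ k q o → suc (k * q) + (k * o + 0) ≡ k * (q + o) + 1
    wrapped = solve-∀

unjoined-mixed-pair : ∀ {q k t t′ e e′} → 1 ≤ t → t < q → t′ < q → e + e′ ≡ 1 →
                      Unjoined q k (k * t + e + (k * t′ + e′))
unjoined-mixed-pair {q} {k} {t} {t′} {e} {e′} 1≤t t<q t′<q e+e′≡1 =
  subst (Unjoined q k) (sym pair-sum)
    (unjoined-k*t+1 (≤-trans 1≤t (m≤m+n t t′)) (+-mono-< t<q t′<q))
  where
    regroup : ∀ k t t′ e e′ → k * t + e + (k * t′ + e′) ≡ k * (t + t′) + (e + e′)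
    regroup = solve-∀
    pair-sum : k * t + e + (k * t′ + e′) ≡ k * (t + t′) + 1
    pair-sum = trans (regroup k t t′ e e′) (cong (k * (t + t′) +_) e+e′≡1)

distinct-bits⇒sum≡1 : ∀ {e e′} → e ≤ 1 → e′ ≤ 1 → e ≢ e′ → e + e′ ≡ 1
distinct-bits⇒sum≡1 z≤n       z≤n       e≢e′ = contradiction refl e≢e′
distinct-bits⇒sum≡1 z≤n       (s≤s z≤n) _    = refl
distinct-bits⇒sum≡1 (s≤s z≤n) z≤n       _    = refl
distinct-bits⇒sum≡1 (s≤s z≤n) (s≤s z≤n) e≢e′ = contradiction refl e≢e′

module Circulant (q k : ℕ) (2≤k : 2 ≤ k) where

  private
    instance
      k≢0 : NonZero k
      k≢0 = >-nonZero (≤-trans (s≤s z≤n) 2≤k)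

    ≤k∸1⇒<k : ∀ {m} → m ≤ k ∸ 1 → m < k
    ≤k∸1⇒<k m≤k∸1 = ≤-<-trans m≤k∸1 (∸-monoʳ-< z<s (≤-trans (s≤s z≤n) 2≤k))

    <k⇒≤k∸1 : ∀ {m} → m < k → m ≤ k ∸ 1
    <k⇒≤k∸1 = ∸-monoˡ-≤ 1

    k*t+e≡e+t*k : ∀ t e → k * t + e ≡ e + t * k
    k*t+e≡e+t*k t e = trans (+-comm (k * t) e) (cong (e +_) (*-comm k t))

  gap<N : ∀ {d} → Gap q k d → d < N q k
  gap<N (gap t e _ t<q e≤1) = m<n⇒m<1+n (k*t+r<k*q t<q (≤-<-trans e≤1 2≤k))

  chord<N : ∀ {d} → Chord q k d → d < N q k
  chord<N (chord j m _ m≤k∸1 j<q) =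
    m<n⇒m<1+n (k*t+r<k*q j<q (≤k∸1⇒<k m≤k∸1))

  1<gap : ∀ {d} → Gap q k d → 1 < d
  1<gap (gap t e 1≤t _ _) = ≤-trans 2≤k (≤-trans (m≤m*n k t ⦃ >-nonZero 1≤t ⦄) (m≤m+n (k * t) e))

  gap≢chord : ∀ {d d′} → Gap q k d → Chord q k d′ → d ≢ d′
  gap≢chord (gap t e _ _ e≤1) (chord j m 2≤m m≤k∸1 _) eq =
    <⇒≢ (≤-trans (s≤s e≤1) 2≤m)
      (remainder-unique {A = t} {B = j} (≤-<-trans e≤1 2≤k) (≤k∸1⇒<k m≤k∸1)
        (trans (sym (k*t+e≡e+t*k t e)) (trans eq (k*t+e≡e+t*k j m))))

  gap-not-next : ∀ {g} {a b : Fin (N q k)} → Gap q k g → Shift g a b → ¬ Shift 1 a b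
  gap-not-next G a→b a→b′ =
    <⇒≢ (1<gap G) (sym (shift-unique (gap<N G) (<-trans (1<gap G) (gap<N G)) a→b a→b′))

  gap-not-adjacent : ∀ {g} {a b : Fin (N q k)} → Gap q k g → Shift g a b → ¬ Adj q k a b
  gap-not-adjacent G a→b (inj₁ b≡a+1) = gap-not-next G a→b (%⇒shift b≡a+1)
  gap-not-adjacent G a→b (inj₂ (inj₁ a≡b+1)) =
    gap-not-next (gap-reverse G) (shift-reverse (<⇒≤ (gap<N G)) a→b) (%⇒shift a≡b+1)
  gap-not-adjacent {a = a} {b = b} G a→b (inj₂ (inj₂ (m , j , 2≤m , m≤k∸1 , j<q , b≡a+kj+m))) =
    gap≢chord G C (shift-unique (gap<N G) (chord<N C) a→b (%⇒shift b≡a+[kj+m]))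
    where
      C : Chord q k (k * j + m)
      C = chord j m 2≤m m≤k∸1 j<q
      b≡a+[kj+m] : toℕ b ≡ (toℕ a + (k * j + m)) % N q k
      b≡a+[kj+m] = trans b≡a+kj+m (cong (_% N q k) (+-assoc (toℕ a) (k * j) m))

  gap-not-edge : ∀ {g} {a b : Fin (N q k)} → Gap q k g → Shift g a b → ¬ Edge q k a b
  gap-not-edge G a→b (inj₁ ab) = gap-not-adjacent G a→b ab
  gap-not-edge G a→b (inj₂ ba) =
    gap-not-adjacent (gap-reverse G) (shift-reverse (<⇒≤ (gap<N G)) a→b) ba

  unjoined-not-edge : ∀ {d} {a b : Fin (N q k)} →
                      Unjoined q k d → Shift d a b → a ≢ b → ¬ Edge q k a b
  unjoined-not-edge loop      a→b a≢b _ = a≢b (shift-zero a→b)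
  unjoined-not-edge (apart G) a→b _     = gap-not-edge G a→b
  unjoined-not-edge (wrap u)  a→b       = unjoined-not-edge u (shift-unwrap a→b)

  difference : ∀ {d} → d < N q k → Difference q k d
  difference {d} d<N =
    subst (Difference q k) (sym d≡) (classify (d / k) (d % k) (m%n<n d k) (subst (_< N q k) d≡ d<N))
    where
      d≡ : d ≡ k * (d / k) + d % k
      d≡ = trans (m≡m%n+[m/n]*n d k) (trans (+-comm (d % k) _) (cong (_+ d % k) (*-comm (d / k) k)))

      above-zero : ∀ t r → r ≤ 1 → k * suc t + r < N q k → Difference q k (k * suc t + r)
      above-zero t r r≤1 bound with suc t <? q
      ... | yes t<q = gap-diff (gap (suc t) r (s≤s z≤n) t<q r≤1)
      ... | no t≮q = subst (Difference q k) (sym at-kq) kq-diff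
        where
          at-kq : k * suc t + r ≡ k * q
          at-kq = ≤-antisym (≤-pred bound) (≤-trans (*-monoʳ-≤ k (≮⇒≥ t≮q)) (m≤m+n _ r))

      classify : ∀ t r → r < k → k * t + r < N q k → Difference q k (k * t + r)
      classify t (suc (suc r)) r<k bound =
        chord-diff (chord t (2 + r) (s≤s (s≤s z≤n)) (<k⇒≤k∸1 r<k) t<q)
        where
          t<q : t < q
          t<q = *-cancelˡ-< k t q (<-≤-trans (m<m+n (k * t) z<s) (≤-pred bound))
      classify zero zero _ _ =
        subst (Difference q k) (sym (trans (+-identityʳ (k * 0)) (*-zeroʳ k))) zero-diff
      classify zero (suc zero) _ _ =
        subst (Difference q k) (sym (cong (_+ 1) (*-zeroʳ k))) one-diff
      classify (suc t) zero       _ bound = above-zero t 0 z≤n bound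
      classify (suc t) (suc zero) _ bound = above-zero t 1 ≤-refl bound

  non-edge-gap : ∀ {a b : Fin (N q k)} → a ≢ b → ¬ Edge q k a b → ∃[ g ] Gap q k g × Shift g a b
  non-edge-gap {a} {b} a≢b ¬ab = let d , d<N , a→b = shift-exists a b in from (difference d<N) a→b
    where
      from : ∀ {d} → Difference q k d → Shift d a b → ∃[ g ] Gap q k g × Shift g a b
      from zero-diff  a→b = contradiction (shift-zero a→b) a≢b
      from one-diff   a→b = contradiction (inj₁ (inj₁ (shift⇒% a→b))) ¬ab
      from kq-diff    a→b = contradiction (inj₁ (inj₂ (inj₁ (shift⇒% b→a)))) ¬ab
        where
          b→a : Shift 1 b a
          b→a = subst (λ s → Shift s b a) (m+n∸n≡m 1 (k * q)) (shift-reverse (n≤1+n (k * q)) a→b)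
      from (chord-diff (chord j m 2≤m m≤k∸1 j<q)) a→b =
        contradiction (inj₁ (inj₂ (inj₂ (m , j , 2≤m , m≤k∸1 , j<q , b≡a+kj+m)))) ¬ab
        where
          b≡a+kj+m : toℕ b ≡ (toℕ a + k * j + m) % N q k
          b≡a+kj+m = trans (shift⇒% a→b) (cong (_% N q k) (sym (+-assoc (toℕ a) (k * j) m)))
      from (gap-diff G) a→b = _ , G , a→b

  -- Modulo k the multiplier of kq + 1 would be 4e (or 0 when 4e = k), yet it lies strictly between 0 and 4.
  N∤k*T+4*e : ∀ {T e} → 4 ≤ k → e ≤ 1 → 1 ≤ T → T < 4 * q → ¬ N q k ∣ k * T + 4 * e
  N∤k*T+4*e {T} {e} _ _ 1≤T _ (divides zero eq) = <⇒≢ positive (sym eq)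
    where
      positive : 0 < k * T + 4 * e
      positive = ≤-trans (≤-trans (s≤s z≤n) 2≤k)
                         (≤-trans (m≤m*n k T ⦃ >-nonZero 1≤T ⦄) (m≤m+n (k * T) (4 * e)))
  N∤k*T+4*e {T} {e} 4≤k e≤1 _ T<4q (divides M@(suc _) eq) = remainders (m≤n⇒m<n∨m≡n 4e≤k)
    where
      4e≤k : 4 * e ≤ k
      4e≤k = ≤-trans (*-monoʳ-≤ 4 e≤1) 4≤k

      M<4 : M < 4
      M<4 = *-cancelʳ-< (N q k) M 4 (begin-strict
        M * N q k      ≡⟨ eq ⟨
        k * T + 4 * e  ≤⟨ +-monoʳ-≤ (k * T) 4e≤k ⟩
        k * T + k      ≡⟨ trans (+-comm (k * T) k) (sym (*-suc k T)) ⟩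
        k * suc T      ≤⟨ *-monoʳ-≤ k T<4q ⟩
        k * (4 * q)    ≡⟨ *-comm-4 k q ⟩
        4 * (k * q)    <⟨ *-monoʳ-< 4 (n<1+n (k * q)) ⟩
        4 * N q k      ∎)
        where
          open ≤-Reasoning
          *-comm-4 : ∀ k q → k * (4 * q) ≡ 4 * (k * q)
          *-comm-4 = solve-∀

      eq′ : 4 * e + T * k ≡ M + M * q * k
      eq′ = trans (sym (k*t+e≡e+t*k T (4 * e))) (trans eq (expand M k q))
        where
          expand : ∀ M k q → M * suc (k * q) ≡ M + M * q * k
          expand = solve-∀

      4e≢M : ∀ {e} → e ≤ 1 → 4 * e ≢ M
      4e≢M z≤n       = 0≢1+n
      4e≢M (s≤s z≤n) = <⇒≢ M<4 ∘ sym

      M<k : M < k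
      M<k = <-≤-trans M<4 4≤k

      remainders : 4 * e < k ⊎ 4 * e ≡ k → ⊥
      remainders (inj₁ 4e<k) = 4e≢M e≤1 (remainder-unique {A = T} {B = M * q} 4e<k M<k eq′)
      remainders (inj₂ 4e≡k) =
        0≢1+n (remainder-unique {A = suc T} {B = M * q} (≤-trans (s≤s z≤n) 2≤k) M<k
                (trans (cong (_+ T * k) (sym 4e≡k)) eq′))

  gap-cycle : ∀ {g₁ g₂ g₃ g₄} → 4 ≤ k → Gap q k g₁ → Gap q k g₂ → Gap q k g₃ → Gap q k g₄ →
              N q k ∣ g₁ + g₂ + g₃ + g₄ →
              Unjoined q k (g₁ + g₂) ⊎ Unjoined q k (g₂ + g₃) ⊎ Unjoined q k (g₃ + g₄)
  gap-cycle 4≤k (gap t₁ e₁ 1≤t₁ t₁<q e₁≤1) (gap t₂ e₂ 1≤t₂ t₂<q e₂≤1) (gap t₃ e₃ 1≤t₃ t₃<q e₃≤1)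
            (gap t₄ e₄ _ t₄<q e₄≤1) N∣sum
    with e₁ ≟ e₂ | e₂ ≟ e₃ | e₃ ≟ e₄
  ... | no e₁≢e₂ | _ | _ =
    inj₁ (unjoined-mixed-pair 1≤t₁ t₁<q t₂<q (distinct-bits⇒sum≡1 e₁≤1 e₂≤1 e₁≢e₂))
  ... | yes refl | no e₂≢e₃ | _ =
    inj₂ (inj₁ (unjoined-mixed-pair 1≤t₂ t₂<q t₃<q (distinct-bits⇒sum≡1 e₂≤1 e₃≤1 e₂≢e₃)))
  ... | yes refl | yes refl | no e₃≢e₄ =
    inj₂ (inj₂ (unjoined-mixed-pair 1≤t₃ t₃<q t₄<q (distinct-bits⇒sum≡1 e₃≤1 e₄≤1 e₃≢e₄)))
  ... | yes refl | yes refl | yes refl =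
    contradiction (subst (N q k ∣_) (uniform-sum k t₁ t₂ t₃ t₄ e₁) N∣sum) (N∤k*T+4*e 4≤k e₁≤1 1≤T T<4q)
    where
      uniform-sum : ∀ k t₁ t₂ t₃ t₄ e → k * t₁ + e + (k * t₂ + e) + (k * t₃ + e) + (k * t₄ + e)
                                       ≡ k * (t₁ + t₂ + t₃ + t₄) + 4 * e
      uniform-sum = solve-∀
      1≤T : 1 ≤ t₁ + t₂ + t₃ + t₄
      1≤T = ≤-trans 1≤t₁ (≤-trans (m≤m+n t₁ t₂)
                           (≤-trans (m≤m+n (t₁ + t₂) t₃) (m≤m+n (t₁ + t₂ + t₃) t₄)))
      T<4q : t₁ + t₂ + t₃ + t₄ < 4 * q
      T<4q = <-≤-trans (+-mono-< (+-mono-< (+-mono-< t₁<q t₂<q) t₃<q) t₄<q) (≤-reflexive (four-q q))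
        where
          four-q : ∀ q → q + q + q + q ≡ 4 * q
          four-q = solve-∀

lemma2p3 : (q k : ℕ) → 4 ≤ k → 1 ≤ q → 2K2-free q k
lemma2p3 q k 4≤k _ a b c d (a≢b , a≢c , a≢d , b≢c , b≢d , c≢d , ab , cd , ¬ac , ¬ad , ¬bc , ¬bd) =
  let open Circulant q k (≤-trans (s≤s (s≤s z≤n)) 4≤k)
      _ , G₁ , a→c = non-edge-gap a≢c ¬ac
      _ , G₂ , c→b = non-edge-gap (b≢c ∘ sym) (¬bc ∘ swap)
      _ , G₃ , b→d = non-edge-gap b≢d ¬bd
      _ , G₄ , d→a = non-edge-gap (a≢d ∘ sym) (¬ad ∘ swap)
      a→b = shift-trans a→c c→b
      c→d = shift-trans c→b b→d
      b→a = shift-trans b→d d→a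
  in case gap-cycle 4≤k G₁ G₂ G₃ G₄ (shift-loop (shift-trans (shift-trans a→b b→d) d→a)) of λ where
       (inj₁ u)        → unjoined-not-edge u a→b a≢b ab
       (inj₂ (inj₁ u)) → unjoined-not-edge u c→d c≢d cd
       (inj₂ (inj₂ u)) → unjoined-not-edge u b→a (a≢b ∘ sym) (swap ab)
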